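{- Let $\mathbb{H}$ be a hypergraph with rank $r(\mathbb{H})$, let $s$ be an integer with $2<s\le r(\mathbb{H})$, and let $[\mathbb{H}]_s$ be the $s$-section of $\mathbb{H}$. Then for all nonnegative integers $h>k$, $\lambda_{h,k}(\mathbb{H})=\lambda_{h,k}([\mathbb{H}]_s)$.
   Context: A hypergraph $\mathbb{H}=(V,E)$ consists of a finite vertex set $V$ and a family $E$ of subsets of $V$ (edges); all hypergraphs are simple: every edge has at least two elements and no edge contains another. The rank $r(\mathbb{H})$ is the maximum cardinality of an edge. For $2\le s\le r(\mathbb{H})$, the $s$-section $[\mathbb{H}]_s$ is the hypergraph on vertex set $V$ whose edges are the sets $e'$ such that either $e'\subseteq e$ for some $e\in E$ with $|e'|=s$, or $e'=e$ for some $e\in E$ with $|e|<s$. For nonnegative integers $h>k$, an $L(h,k)$-colouring of a hypergraph is a map $f$ from its vertex set to $\mathbb{Z}_{\ge0}$ such that $|f(u)-f(v)|\ge h$ whenever $u\neq v$ lie in a common edge, and $|f(u)-f(v)|\ge k$ whenever $u\ne v$ and there exist edges $e_1\ni v$, $e_2\ni u$ with $(e_1\cap e_2)\setminus\{u,v\}\neq\emptyset$. The span of $f$ is $\max f-\min f$; $\lambda_{h,k}$ is the minimum span of an $L(h,k)$-colouring. -}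

module Defs where

open import Data.Nat using (ℕ; zero; suc; _≤_; _<_; _≥_; _⊔_; _⊓_; _∸_; ∣_-_∣)
open import Data.Fin using (Fin; zero)
import Data.Fin as Fin
open import Data.Fin.Subset using (Subset; _∈_; _⊆_; ∣_∣)
open import Data.Product using (Σ; ∃; _×_; _,_)
open import Data.Sum using (_⊎_)
open import Relation.Nullary using (¬_)
open import Relation.Binary.PropositionalEquality using (_≡_; _≢_)
open import Function using (_∘_)

-- A hypergraph on the vertex set Fin n; the edge family is given as a
-- predicate on subsets of Fin n (automatically a finite family).
record Hypergraph : Set₁ where
  field
    n    : ℕ
    Edge : Subset n → Set
    edge-size : ∀ e → Edge e → 2 ≤ ∣ e ∣
    no-containment : ∀ e e′ → Edge e → Edge e′ → e ⊆ e′ → e ≡ e′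

open Hypergraph public

IsRank : (H : Hypergraph) → ℕ → Set
IsRank H r = (∃ λ e → Edge H e × ∣ e ∣ ≡ r) × (∀ e → Edge H e → ∣ e ∣ ≤ r)

SectionEdge : (H : Hypergraph) → ℕ → Subset (n H) → Set
SectionEdge H s e′ =
  ∃ λ e → Edge H e × ((e′ ⊆ e × ∣ e′ ∣ ≡ s) ⊎ (e′ ≡ e × ∣ e ∣ < s))

IsLColouring : {m : ℕ} → (Subset m → Set) → ℕ → ℕ → (Fin m → ℕ) → Set
IsLColouring {m} E h k f =
  (∀ (u v : Fin m) (e : Subset m) → u ≢ v → E e → u ∈ e → v ∈ e →
      h ≤ ∣ f u - f v ∣) ×
  (∀ (u v w : Fin m) (e₁ e₂ : Subset m) → u ≢ v → E e₁ → E e₂ →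
      v ∈ e₁ → u ∈ e₂ → w ∈ e₁ → w ∈ e₂ → w ≢ u → w ≢ v →
      k ≤ ∣ f u - f v ∣)

maxVal : {m : ℕ} → (Fin m → ℕ) → ℕ
maxVal {zero}  f = 0
maxVal {suc m} f = f zero ⊔ maxVal (f ∘ Fin.suc)

minVal : {m : ℕ} → (Fin m → ℕ) → ℕ
minVal {zero}        f = 0
minVal {suc zero}    f = f zero
minVal {suc (suc m)} f = f zero ⊓ minVal (f ∘ Fin.suc)

span : {m : ℕ} → (Fin m → ℕ) → ℕ
span f = maxVal f ∸ minVal f

IsLambda : {m : ℕ} → (Subset m → Set) → ℕ → ℕ → ℕ → Set
IsLambda E h k l =
  (∃ λ f → IsLColouring E h k f × span f ≡ l) ×
  (∀ f → IsLColouring E h k f → l ≤ span f)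

-- An L(h,k)-colouring only sees which pairs of vertices lie in a common edge:
-- both conditions speak about u, v, w only through such pairs.  For s ≥ 2 a
-- hypergraph and its s-section have the same such pairs: every edge of [H]_s
-- lies inside an edge of H, and two vertices of an edge e of H lie in a common
-- s-subset of e (or in e itself when |e| < s).  So both hypergraphs have the
-- same L(h,k)-colourings, hence the same λ_{h,k}.
module Submission where

open import Defs
open import Data.Nat using (ℕ; zero; suc; _+_; _<_; _≤_; z≤n; s≤s)
open import Data.Nat.Properties
  using (≤-trans; ≤-antisym; +-suc; +-monoʳ-≤; ≰⇒>; <⇒≤; ≮⇒≥; _≤?_; _<?_)
open import Data.Bool using (true; false)
open import Data.Vec using ([]; _∷_; here)
open import Data.Fin using (Fin)
open import Data.Fin.Subset using (Subset; _∈_; _⊆_; ∣_∣; _∪_; ⁅_⁆)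
open import Data.Fin.Subset.Properties
  using (drop-∷-⊆; out⊆; in⊆in; ⊆-refl; ∣p∣≤∣x∷p∣; p⊆p∪q; q⊆p∪q; x∈p∪q⁻;
         x∈⁅x⁆; x∈⁅y⁆⇒x≡y; ∣⁅x⁆∣≡1)
open import Data.Product using (∃; _×_; _,_)
open import Data.Sum using (inj₁; inj₂)
open import Relation.Nullary using (yes; no)
open import Relation.Binary.PropositionalEquality using (_≡_; refl; sym; cong; cong₂; subst)
open import Function.Bundles using (_⇔_; mk⇔)

private
  variable
    m : ℕ

∣p∪q∣≤∣p∣+∣q∣ : (p q : Subset m) → ∣ p ∪ q ∣ ≤ ∣ p ∣ + ∣ q ∣
∣p∪q∣≤∣p∣+∣q∣ []          []          = z≤n
∣p∪q∣≤∣p∣+∣q∣ (true ∷ p)  (x ∷ q)     = s≤s (≤-trans (∣p∪q∣≤∣p∣+∣q∣ p q) (+-monoʳ-≤ ∣ p ∣ (∣p∣≤∣x∷p∣ x q)))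
∣p∪q∣≤∣p∣+∣q∣ (false ∷ p) (true ∷ q)  = subst (suc ∣ p ∪ q ∣ ≤_) (sym (+-suc ∣ p ∣ ∣ q ∣)) (s≤s (∣p∪q∣≤∣p∣+∣q∣ p q))
∣p∪q∣≤∣p∣+∣q∣ (false ∷ p) (false ∷ q) = ∣p∪q∣≤∣p∣+∣q∣ p q

⊆-between-of-size : ∀ (t e : Subset m) s → t ⊆ e → ∣ t ∣ ≤ s → s ≤ ∣ e ∣ →
                    ∃ λ e′ → t ⊆ e′ × e′ ⊆ e × ∣ e′ ∣ ≡ s
⊆-between-of-size [] [] zero _ _ _ = [] , ⊆-refl , ⊆-refl , refl
⊆-between-of-size (true ∷ t) (false ∷ e) s t⊆e _ _ with t⊆e here
... | ()
⊆-between-of-size (true ∷ t) (true ∷ e) (suc s) t⊆e (s≤s ∣t∣≤s) (s≤s s≤∣e∣)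
  with ⊆-between-of-size t e s (drop-∷-⊆ t⊆e) ∣t∣≤s s≤∣e∣
... | e′ , t⊆e′ , e′⊆e , ∣e′∣≡s = true ∷ e′ , in⊆in t⊆e′ , in⊆in e′⊆e , cong suc ∣e′∣≡s
⊆-between-of-size (false ∷ t) (false ∷ e) s t⊆e ∣t∣≤s s≤∣e∣
  with ⊆-between-of-size t e s (drop-∷-⊆ t⊆e) ∣t∣≤s s≤∣e∣
... | e′ , t⊆e′ , e′⊆e , ∣e′∣≡s = false ∷ e′ , out⊆ t⊆e′ , out⊆ e′⊆e , ∣e′∣≡s
⊆-between-of-size (false ∷ t) (true ∷ e) s t⊆e ∣t∣≤s s≤1+∣e∣ with s ≤? ∣ e ∣
... | yes s≤∣e∣ with ⊆-between-of-size t e s (drop-∷-⊆ t⊆e) ∣t∣≤s s≤∣e∣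
...   | e′ , t⊆e′ , e′⊆e , ∣e′∣≡s = false ∷ e′ , out⊆ t⊆e′ , out⊆ e′⊆e , ∣e′∣≡s
⊆-between-of-size (false ∷ t) (true ∷ e) s t⊆e ∣t∣≤s s≤1+∣e∣ | no s≰∣e∣ =
  true ∷ e , out⊆ (drop-∷-⊆ t⊆e) , ⊆-refl , ≤-antisym (≰⇒> s≰∣e∣) s≤1+∣e∣

pair⊆-of-size : ∀ (e : Subset m) s {a b} → 2 ≤ s → s ≤ ∣ e ∣ → a ∈ e → b ∈ e →
                ∃ λ e′ → e′ ⊆ e × ∣ e′ ∣ ≡ s × a ∈ e′ × b ∈ e′
pair⊆-of-size e s {a} {b} 2≤s s≤∣e∣ a∈e b∈e
  with ⊆-between-of-size (⁅ a ⁆ ∪ ⁅ b ⁆) e s ab⊆e ∣ab∣≤s s≤∣e∣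
  where
  ab⊆e : ⁅ a ⁆ ∪ ⁅ b ⁆ ⊆ e
  ab⊆e x∈ab with x∈p∪q⁻ ⁅ a ⁆ ⁅ b ⁆ x∈ab
  ... | inj₁ x∈⁅a⁆ = subst (_∈ e) (sym (x∈⁅y⁆⇒x≡y a x∈⁅a⁆)) a∈e
  ... | inj₂ x∈⁅b⁆ = subst (_∈ e) (sym (x∈⁅y⁆⇒x≡y b x∈⁅b⁆)) b∈e
  ∣ab∣≤s : ∣ ⁅ a ⁆ ∪ ⁅ b ⁆ ∣ ≤ s
  ∣ab∣≤s = ≤-trans (∣p∪q∣≤∣p∣+∣q∣ ⁅ a ⁆ ⁅ b ⁆)
                   (subst (_≤ s) (sym (cong₂ _+_ (∣⁅x⁆∣≡1 a) (∣⁅x⁆∣≡1 b))) 2≤s)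
... | e′ , ab⊆e′ , e′⊆e , ∣e′∣≡s =
  e′ , e′⊆e , ∣e′∣≡s , ab⊆e′ (p⊆p∪q ⁅ b ⁆ (x∈⁅x⁆ a)) , ab⊆e′ (q⊆p∪q ⁅ a ⁆ ⁅ b ⁆ (x∈⁅x⁆ b))

InCommonEdge : (Subset m → Set) → Fin m → Fin m → Set
InCommonEdge E u v = ∃ λ e → E e × u ∈ e × v ∈ e

_⊑_ : (E E′ : Subset m → Set) → Set
E ⊑ E′ = ∀ {u v} → InCommonEdge E u v → InCommonEdge E′ u v

module _ {E E′ : Subset m → Set} (E⊑E′ : E ⊑ E′) {h k : ℕ} where

  IsLColouring-antitone : ∀ {f} → IsLColouring E′ h k f → IsLColouring E h k f
  IsLColouring-antitone (far , near) =
    (λ u v e u≢v Ee u∈e v∈e →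
       let (e′ , E′e′ , u∈e′ , v∈e′) = E⊑E′ (e , Ee , u∈e , v∈e)
       in far u v e′ u≢v E′e′ u∈e′ v∈e′) ,
    (λ u v w e₁ e₂ u≢v Ee₁ Ee₂ v∈e₁ u∈e₂ w∈e₁ w∈e₂ w≢u w≢v →
       let (e₁′ , E′e₁′ , v∈e₁′ , w∈e₁′) = E⊑E′ (e₁ , Ee₁ , v∈e₁ , w∈e₁)
           (e₂′ , E′e₂′ , u∈e₂′ , w∈e₂′) = E⊑E′ (e₂ , Ee₂ , u∈e₂ , w∈e₂)
       in near u v w e₁′ e₂′ u≢v E′e₁′ E′e₂′ v∈e₁′ u∈e₂′ w∈e₁′ w∈e₂′ w≢u w≢v)

IsLambda-cong : {E E′ : Subset m → Set} → E ⊑ E′ → E′ ⊑ E →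
                ∀ {h k l} → IsLambda E h k l ⇔ IsLambda E′ h k l
IsLambda-cong E⊑E′ E′⊑E = mk⇔ (transfer E⊑E′ E′⊑E) (transfer E′⊑E E⊑E′)
  where
  transfer : ∀ {E E′ : Subset _ → Set} → E ⊑ E′ → E′ ⊑ E →
             ∀ {h k l} → IsLambda E h k l → IsLambda E′ h k l
  transfer E⊑E′ E′⊑E ((f , colouring , span≡l) , minimal) =
    (f , IsLColouring-antitone E′⊑E {f = f} colouring , span≡l) ,
    λ g colouring′ → minimal g (IsLColouring-antitone E⊑E′ {f = g} colouring′)

module _ (H : Hypergraph) (s : ℕ) where

  section⊑edges : SectionEdge H s ⊑ Edge H
  section⊑edges (e′ , (e , Ee , inj₁ (e′⊆e , _)) , u∈e′ , v∈e′) = e , Ee , e′⊆e u∈e′ , e′⊆e v∈e′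
  section⊑edges (e′ , (e , Ee , inj₂ (refl , _)) , u∈e′ , v∈e′) = e , Ee , u∈e′ , v∈e′

  edges⊑section : 2 ≤ s → Edge H ⊑ SectionEdge H s
  edges⊑section 2≤s (e , Ee , u∈e , v∈e) with ∣ e ∣ <? s
  ... | yes ∣e∣<s = e , (e , Ee , inj₂ (refl , ∣e∣<s)) , u∈e , v∈e
  ... | no ∣e∣≮s with pair⊆-of-size e s 2≤s (≮⇒≥ ∣e∣≮s) u∈e v∈e
  ...   | e′ , e′⊆e , ∣e′∣≡s , u∈e′ , v∈e′ = e′ , (e , Ee , inj₁ (e′⊆e , ∣e′∣≡s)) , u∈e′ , v∈e′

mainTheorem9 : (H : Hypergraph) (r s : ℕ) → IsRank H r → 2 < s → s ≤ r →
    (h k : ℕ) → k < h →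
    ∀ l → IsLambda (Edge H) h k l ⇔ IsLambda (SectionEdge H s) h k l
mainTheorem9 H r s _ 2<s _ h k _ l =
  IsLambda-cong (edges⊑section H s (<⇒≤ 2<s)) (section⊑edges H s)
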